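{- Let $m$ be an $n$-variable monomial of degree $k$. Then $N_k(m)=\{U\in\mathcal{U}_{n,k}:\ \mathrm{rank}(G_U[\mathrm{Var}(m)])=k\}$.
   Context: $\mathcal{U}_{n,k}$ is the set of $k$-dimensional linear subspaces of $\mathbb{F}_2^n$. For $U\in\mathcal{U}_{n,k}$, $G_U$ is the unique $k\times n$ matrix over $\mathbb{F}_2$ of rank $k$ in reduced row echelon form whose rows span $U$. For $I\subseteq[n]$, $G_U[I]$ is the submatrix of $G_U$ formed by the columns indexed by $I$. For a monomial $m=\prod_{i\in I}x_i$, $\mathrm{Var}(m)=I$. $N_k(m)$ is the set of $U\in\mathcal{U}_{n,k}$ with $\sum_{x\in U}m(x)\neq 0$ (in $\mathbb{F}_2$). Ranks are over $\mathbb{F}_2$. -}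

module Defs where

open import Data.Bool using (Bool; true; false; _∧_; _∨_; _xor_; not; if_then_else_)
open import Data.Nat using (ℕ; zero; suc; _⊔_; _<_)
open import Data.Fin using (Fin; zero; suc)
open import Data.List.Base using (List; []; _∷_; map; foldr; concatMap; allFin; filter; length)
open import Data.List using (lookup)
open import Data.Product using (Σ; ∃; _×_; _,_)
open import Relation.Binary.PropositionalEquality using (_≡_; _≢_)
open import Relation.Nullary using (¬_)
open import Data.Bool.Properties using (T?)

-- F₂ = Bool (addition = xor, multiplication = ∧).
-- Vectors in F₂ⁿ are functions Fin n → Bool; a k×n matrix is Fin k → Fin n → Bool.

Vec2 : ℕ → Set
Vec2 n = Fin n → Bool

Mat2 : ℕ → ℕ → Set
Mat2 r c = Fin r → Fin c → Bool

allB : {A : Set} → (A → Bool) → List A → Bool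
allB p = foldr (λ a b → p a ∧ b) true

allVecs : (n : ℕ) → List (Vec2 n)
allVecs zero = (λ ()) ∷ []
allVecs (suc n) = concatMap (λ v → (λ { zero → false ; (suc i) → v i })
                                 ∷ (λ { zero → true ; (suc i) → v i }) ∷ []) (allVecs n)

sumF2 : List Bool → Bool
sumF2 = foldr _xor_ false

combo : ∀ {r c} → Mat2 r c → Vec2 r → Vec2 c
combo {r} M c j = sumF2 (map (λ i → c i ∧ M i j) (allFin r))

isZero : ∀ {n} → Vec2 n → Bool
isZero {n} v = allB (λ i → not (v i)) (allFin n)

size : ∀ {n} → Vec2 n → ℕ
size {n} v = length (filter (λ i → T? (v i)) (allFin n))

subsetOf : ∀ {n} → Vec2 n → Vec2 n → Bool
subsetOf {n} c S = allB (λ i → not (c i) ∨ S i) (allFin n)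

indepRows : ∀ {r c} → Mat2 r c → Vec2 r → Bool
indepRows {r} M S =
  allB (λ a → not (subsetOf a S ∧ not (isZero a)) ∨ not (isZero (combo M a))) (allVecs r)

rank : ∀ {r c} → Mat2 r c → ℕ
rank {r} M = foldr _⊔_ 0 (map (λ S → if indepRows M S then size S else 0) (allVecs r))

-- the list of elements of I ⊆ [n], in increasing order
elems : ∀ {n} → Vec2 n → List (Fin n)
elems {n} I = filter (λ i → T? (I i)) (allFin n)

submatrix : ∀ {k n} → Mat2 k n → (I : Vec2 n) → Mat2 k (length (elems I))
submatrix G I i j = G i (lookup (elems I) j)

-- A monomial in x₁..xₙ over F₂ (squarefree), given by Var(m) ⊆ [n].
record Monomial (n : ℕ) : Set where
  constructor mono
  field
    Var : Vec2 n

open Monomial public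

degree : ∀ {n} → Monomial n → ℕ
degree m = size (Var m)

evalMono : ∀ {n} → Monomial n → Vec2 n → Bool
evalMono {n} m x = allB (λ i → not (Var m i) ∨ x i) (allFin n)

IsSubspace : ∀ {n} → (Vec2 n → Bool) → Set
IsSubspace {n} U =
  (U (λ _ → false) ≡ true) ×
  (∀ x y → U x ≡ true → U y ≡ true → U (λ i → x i xor y i) ≡ true)

IsRREF : ∀ {k n} → Mat2 k n → Set
IsRREF {k} {n} G = Σ (Fin k → Fin n) λ p →
    (∀ i j → Data.Fin._<_ i j → Data.Fin._<_ (p i) (p j))
  × (∀ i → G i (p i) ≡ true)
  × (∀ i l → Data.Fin._<_ l (p i) → G i l ≡ false)
  × (∀ i j → i ≢ j → G j (p i) ≡ false)

RowSpan : ∀ {k n} → Mat2 k n → (Vec2 n → Bool) → Set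
RowSpan {k} {n} G U = ∀ x → (U x ≡ true → ∃ λ c → ∀ j → combo G c j ≡ x j)
                          × ((∃ λ c → ∀ j → combo G c j ≡ x j) → U x ≡ true)

sumOver : ∀ {n} → (Vec2 n → Bool) → (Vec2 n → Bool) → Bool
sumOver {n} U f = sumF2 (map (λ x → U x ∧ f x) (allVecs n))

-- U ∈ N_k(m)  ⇔  Σ_{x∈U} m(x) ≠ 0
InN : ∀ {n} → Monomial n → (Vec2 n → Bool) → Set
InN m U = sumOver U (evalMono m) ≡ true

{-# OPTIONS --safe #-}
-- Because the pivot columns of G are unit vectors, c ↦ c G is a bijection from F₂ᵏ onto U, and
-- m(c G) = 1 exactly when c A = 𝟙 for the k×k matrix A = G[Var(m)]. So Σ_{x∈U} m(x) is the parity
-- of the number of solutions of c A = 𝟙. If the rows of A are independent, c ↦ c A is injective,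
-- hence bijective, and there is exactly one solution; otherwise a nonzero a with a A = 0 pairs each
-- solution c with c + a, and the number of solutions is even. Finally, rank A = k exactly when all
-- k rows of A are independent.
module Submission where

open import Defs
open import Algebra.Bundles using (CommutativeRing)
open import Data.Bool using (Bool; true; false; _∧_; _∨_; _xor_; not; T; if_then_else_)
open import Data.Bool.Properties
  using (xor-assoc; xor-comm; xor-same; xor-identityʳ; ∧-distribʳ-xor; ∧-zeroʳ; ∧-identityʳ;
         ∨-zeroʳ; ∨-identityʳ; not-injective; T-≡; T?; ⇔→≡; xor-∧-commutativeRing)
open import Algebra.Properties.CommutativeSemigroup
  (CommutativeRing.+-commutativeSemigroup xor-∧-commutativeRing) using (interchange)
open import Data.Empty using (⊥-elim)
open import Data.Fin using (Fin; zero; suc; funToFin; finToFun; punchOut; combine)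
open import Data.Fin.Properties
  using (2↔Bool; funToFin-finToFin; finToFun-funToFin; _≟_; any?; injective⇒≤; punchOut-injective;
         suc-injective)
open import Data.List using (List; []; _∷_; map; concatMap; allFin; filter; length; tabulate; lookup)
open import Data.List.Properties
  using (map-cong; map-tabulate; foldr-map; tabulate-lookup; length-tabulate; length-filter; filter-all; filter-notAll;
         foldr-preservesᵇ; foldr-preservesᵒ)
open import Data.List.Membership.Propositional using (_∈_; lose)
open import Data.List.Membership.Propositional.Properties
  using (∈-allFin; ∈-map⁺; ∈-map⁻; ∈-concat⁺′; foldr-selective)
open import Data.List.Relation.Unary.All using (All; universal)
import Data.List.Relation.Unary.All.Properties as All
open import Data.List.Relation.Unary.Any using (here; there)
open import Data.Nat using (ℕ; zero; suc; _^_; _⊔_; _≤_; _<_; z≤n)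
open import Data.Nat.Properties
  using (⊔-lub; ⊔-sel; m≤n⇒m≤n⊔o; m≤n⇒m≤o⊔n; ≤-refl; ≤-reflexive; ≤-trans; ≤-antisym;
         1+n≰n; n≮n; 0≢1+n; module ≤-Reasoning)
open import Data.Product using (∃; _×_; _,_; proj₁; proj₂)
open import Data.Sum using (inj₁; inj₂; [_,_])
open import Data.Vec.Functional using (head; tail; zipWith) renaming (_∷_ to _◂_)
open import Function using (_∘_; id; const; _⇔_; mk⇔; Equivalence; Inverse; Injection)
open import Function.Properties.Inverse using (↔⇒↣)
open import Function.Definitions using (Congruent; Injective)
open import Relation.Binary.PropositionalEquality
  using (_≡_; _≢_; _≗_; refl; sym; trans; cong; cong₂; subst; subst₂; module ≡-Reasoning)
open import Relation.Nullary using (yes; no)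

private
  variable
    A B : Set
    k n r s : ℕ

_⊕_ : Vec2 n → Vec2 n → Vec2 n
_⊕_ = zipWith _xor_

◂-cong : ∀ b {v w : Vec2 n} → v ≗ w → b ◂ v ≗ b ◂ w
◂-cong b v≗w zero    = refl
◂-cong b v≗w (suc i) = v≗w i

∧-≡true : ∀ x {y} → x ∧ y ≡ true → x ≡ true × y ≡ true
∧-≡true true y≡true = refl , y≡true

sumF2-xor : (f g : A → Bool) (xs : List A) →
  sumF2 (map (λ x → f x xor g x) xs) ≡ sumF2 (map f xs) xor sumF2 (map g xs)
sumF2-xor f g []       = refl
sumF2-xor f g (x ∷ xs) =
  trans (cong ((f x xor g x) xor_) (sumF2-xor f g xs)) (interchange (f x) (g x) _ _)

sumF2-concatMap-pair : (a b : A → B) (g : B → Bool) (xs : List A) →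
  sumF2 (map g (concatMap (λ x → a x ∷ b x ∷ []) xs)) ≡ sumF2 (map (g ∘ a) xs) xor sumF2 (map (g ∘ b) xs)
sumF2-concatMap-pair a b g []       = refl
sumF2-concatMap-pair a b g (x ∷ xs) = begin
  g (a x) xor (g (b x) xor rest)          ≡⟨ xor-assoc (g (a x)) (g (b x)) rest ⟨
  (g (a x) xor g (b x)) xor rest          ≡⟨ cong ((g (a x) xor g (b x)) xor_) (sumF2-concatMap-pair a b g xs) ⟩
  (g (a x) xor g (b x)) xor (as xor bs)   ≡⟨ interchange (g (a x)) (g (b x)) as bs ⟩
  (g (a x) xor as) xor (g (b x) xor bs)   ∎
  where
  open ≡-Reasoning
  rest = sumF2 (map g (concatMap (λ x → a x ∷ b x ∷ []) xs))
  as   = sumF2 (map (g ∘ a) xs)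
  bs   = sumF2 (map (g ∘ b) xs)

sumF2-false : {xs : List Bool} → All (_≡ false) xs → sumF2 xs ≡ false
sumF2-false = foldr-preservesᵇ (λ { refl refl → refl }) refl

sumF2-tabulate-single : (f : Fin n → Bool) (i : Fin n) → (∀ j → j ≢ i → f j ≡ false) →
  sumF2 (tabulate f) ≡ f i
sumF2-tabulate-single f zero    others = trans
  (cong (f zero xor_) (sumF2-false (All.tabulate⁺ (λ j → others (suc j) λ ()))))
  (xor-identityʳ (f zero))
sumF2-tabulate-single f (suc i) others = cong₂ _xor_ (others zero λ ())
  (sumF2-tabulate-single (f ∘ suc) i (λ j j≢i → others (suc j) (j≢i ∘ suc-injective)))

-- Sums over F₂ⁿ

-- Structural recursion on n, unlike the enumeration allVecs of Defs, makes the laws below hold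
-- without congruence hypotheses on the summand; sumF2-allVecs relates the two.
sumVecs : ∀ n → (Vec2 n → Bool) → Bool
sumVecs zero    g = g (λ ())
sumVecs (suc n) g = sumVecs n (g ∘ (false ◂_)) xor sumVecs n (g ∘ (true ◂_))

sumVecs-cong : ∀ n {f g : Vec2 n → Bool} → f ≗ g → sumVecs n f ≡ sumVecs n g
sumVecs-cong zero    f≗g = f≗g _
sumVecs-cong (suc n) f≗g =
  cong₂ _xor_ (sumVecs-cong n (f≗g ∘ (false ◂_))) (sumVecs-cong n (f≗g ∘ (true ◂_)))

sumF2-allVecs : ∀ n (g : Vec2 n → Bool) → Congruent _≗_ _≡_ g →
  sumF2 (map g (allVecs n)) ≡ sumVecs n g
sumF2-allVecs zero    g g-cong = trans (xor-identityʳ _) (g-cong (λ ()))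
sumF2-allVecs (suc n) g g-cong = trans
  (sumF2-concatMap-pair _ _ g (allVecs n))
  (cong₂ _xor_ (half false _ (λ v → λ { zero → refl ; (suc i) → refl }))
               (half true  _ (λ v → λ { zero → refl ; (suc i) → refl })))
  where
  half : ∀ b (a : Vec2 n → Vec2 (suc n)) → (∀ v → a v ≗ b ◂ v) →
    sumF2 (map (g ∘ a) (allVecs n)) ≡ sumVecs n (g ∘ (b ◂_))
  half b a a≗b◂ = trans (cong sumF2 (map-cong (g-cong ∘ a≗b◂) (allVecs n)))
                        (sumF2-allVecs n (g ∘ (b ◂_)) (g-cong ∘ ◂-cong b))

sumVecs-false : ∀ n → sumVecs n (const false) ≡ false
sumVecs-false zero    = refl
sumVecs-false (suc n) = cong₂ _xor_ (sumVecs-false n) (sumVecs-false n)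

sumVecs-xor : ∀ n (f g : Vec2 n → Bool) →
  sumVecs n (λ c → f c xor g c) ≡ sumVecs n f xor sumVecs n g
sumVecs-xor zero    f g = refl
sumVecs-xor (suc n) f g = trans
  (cong₂ _xor_ (sumVecs-xor n (f ∘ (false ◂_)) (g ∘ (false ◂_)))
               (sumVecs-xor n (f ∘ (true ◂_)) (g ∘ (true ◂_))))
  (interchange (sumVecs n (f ∘ (false ◂_))) (sumVecs n (g ∘ (false ◂_)))
               (sumVecs n (f ∘ (true ◂_))) (sumVecs n (g ∘ (true ◂_))))

sumVecs-∧ʳ : ∀ n (f : Vec2 n → Bool) b → sumVecs n (λ c → f c ∧ b) ≡ sumVecs n f ∧ b
sumVecs-∧ʳ zero    f b = refl
sumVecs-∧ʳ (suc n) f b = trans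
  (cong₂ _xor_ (sumVecs-∧ʳ n (f ∘ (false ◂_)) b) (sumVecs-∧ʳ n (f ∘ (true ◂_)) b))
  (sym (∧-distribʳ-xor b (sumVecs n (f ∘ (false ◂_))) (sumVecs n (f ∘ (true ◂_)))))

sumVecs-swap : ∀ m n (F : Vec2 m → Vec2 n → Bool) →
  sumVecs m (λ x → sumVecs n (F x)) ≡ sumVecs n (λ c → sumVecs m (λ x → F x c))
sumVecs-swap zero    n F = refl
sumVecs-swap (suc m) n F = trans
  (cong₂ _xor_ (sumVecs-swap m n (F ∘ (false ◂_))) (sumVecs-swap m n (F ∘ (true ◂_))))
  (sym (sumVecs-xor n (λ c → sumVecs m (λ x → F (false ◂ x) c))
                      (λ c → sumVecs m (λ x → F (true ◂ x) c))))

sumVecs-translate : ∀ n (g : Vec2 n → Bool) → Congruent _≗_ _≡_ g →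
  ∀ a → sumVecs n (λ c → g (c ⊕ a)) ≡ sumVecs n g
sumVecs-translate zero    g g-cong a = g-cong (λ ())
sumVecs-translate (suc n) g g-cong a =
  trans (cong₂ _xor_ (shift false) (shift true)) (swap-halves (head a))
  where
  half : Bool → Bool
  half b = sumVecs n (g ∘ (b ◂_))
  shift : ∀ b → sumVecs n (λ v → g ((b ◂ v) ⊕ a)) ≡ half (b xor head a)
  shift b = trans
    (sumVecs-cong n (λ v → g-cong λ { zero → refl ; (suc i) → refl }))
    (sumVecs-translate n (g ∘ ((b xor head a) ◂_)) (g-cong ∘ ◂-cong _) (tail a))
  swap-halves : ∀ x → half (false xor x) xor half (true xor x) ≡ half false xor half true
  swap-halves false = refl
  swap-halves true  = xor-comm (half true) (half false)

-- An involution c ↦ c ⊕ a without fixed points pairs off the terms of the sum.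
sumVecs-periodic : ∀ n (g : Vec2 n → Bool) → Congruent _≗_ _≡_ g →
  ∀ a i → a i ≡ true → (∀ c → g (c ⊕ a) ≡ g c) → sumVecs n g ≡ false
sumVecs-periodic n g g-cong a i aᵢ≡true periodic = begin
  sumVecs n g                          ≡⟨ sumVecs-cong n split ⟩
  sumVecs n (λ c → on c xor off c)     ≡⟨ sumVecs-xor n on off ⟩
  sumVecs n on xor sumVecs n off       ≡⟨ cong (_xor sumVecs n off) on≡off ⟩
  sumVecs n off xor sumVecs n off      ≡⟨ xor-same (sumVecs n off) ⟩
  false                                ∎
  where
  open ≡-Reasoning
  on off : Vec2 n → Bool
  on  c = c i ∧ g c
  off c = not (c i) ∧ g c
  split : ∀ c → g c ≡ on c xor off c
  split c with c i
  ... | true  = sym (xor-identityʳ (g c))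
  ... | false = refl
  on-shift : ∀ c → on (c ⊕ a) ≡ off c
  on-shift c rewrite aᵢ≡true | periodic c with c i
  ... | true  = refl
  ... | false = refl
  on≡off : sumVecs n on ≡ sumVecs n off
  on≡off = trans (sym (sumVecs-translate n on (λ v≗w → cong₂ _∧_ (v≗w i) (g-cong v≗w)) a))
                 (sumVecs-cong n on-shift)

_==_ : Vec2 n → Vec2 n → Bool
_==_ {zero}  v w = true
_==_ {suc n} v w = not (head v xor head w) ∧ (tail v == tail w)

==-sound : (v w : Vec2 n) → v == w ≡ true → v ≗ w
==-sound {suc n} v w eq zero with v zero | w zero | proj₁ (∧-≡true (not (v zero xor w zero)) eq)
... | false | false | _ = refl
... | true  | true  | _ = refl
... | false | true  | ()
... | true  | false | ()
==-sound {suc n} v w eq (suc i) =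
  ==-sound (tail v) (tail w) (proj₂ (∧-≡true (not (v zero xor w zero)) eq)) i

==-complete : {v w : Vec2 n} → v ≗ w → v == w ≡ true
==-complete {zero}          v≗w = refl
==-complete {suc n} {v} {w} v≗w rewrite v≗w zero =
  cong₂ _∧_ (cong not (xor-same (w zero))) (==-complete (v≗w ∘ suc))

==-cong : {v v′ w w′ : Vec2 n} → v ≗ v′ → w ≗ w′ → v == w ≡ v′ == w′
==-cong {zero}  v≗v′ w≗w′ = refl
==-cong {suc n} v≗v′ w≗w′ =
  cong₂ (λ x y → not x ∧ y) (cong₂ _xor_ (v≗v′ zero) (w≗w′ zero)) (==-cong (v≗v′ ∘ suc) (w≗w′ ∘ suc))

sumVecs-== : ∀ n (d : Vec2 n) → sumVecs n (_== d) ≡ true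
sumVecs-== zero    d = refl
sumVecs-== (suc n) d = trans (halves (head d)) (sumVecs-== n (tail d))
  where
  halves : ∀ x → sumVecs n (λ v → not (false xor x) ∧ (v == tail d))
             xor sumVecs n (λ v → not (true xor x) ∧ (v == tail d)) ≡ sumVecs n (_== tail d)
  halves false = trans (cong (sumVecs n (_== tail d) xor_) (sumVecs-false n)) (xor-identityʳ _)
  halves true  = cong (_xor sumVecs n (_== tail d)) (sumVecs-false n)

sumVecs-sift : ∀ n (d : Vec2 n) (g : Vec2 n → Bool) → Congruent _≗_ _≡_ g →
  sumVecs n (λ c → (c == d) ∧ g c) ≡ g d
sumVecs-sift n d g g-cong = begin
  sumVecs n (λ c → (c == d) ∧ g c)  ≡⟨ sumVecs-cong n at-d ⟩
  sumVecs n (λ c → (c == d) ∧ g d)  ≡⟨ sumVecs-∧ʳ n (_== d) (g d) ⟩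
  sumVecs n (_== d) ∧ g d           ≡⟨ cong (_∧ g d) (sumVecs-== n d) ⟩
  g d                               ∎
  where
  open ≡-Reasoning
  at-d : ∀ c → (c == d) ∧ g c ≡ (c == d) ∧ g d
  at-d c with c == d in c==d
  ... | true  = g-cong (==-sound c d c==d)
  ... | false = refl

-- Double counting over the pairs (x , c) with x = L c: each side collapses by sifting.
sumVecs-section : (L : Vec2 k → Vec2 n) (π : Vec2 n → Vec2 k) →
  Congruent _≗_ _≗_ L → Congruent _≗_ _≗_ π → (∀ c → π (L c) ≗ c) →
  (h : Vec2 n → Bool) → Congruent _≗_ _≡_ h →
  sumVecs n (λ x → (x == L (π x)) ∧ h x) ≡ sumVecs k (h ∘ L)
sumVecs-section {k} {n} L π L-cong π-cong πL≗id h h-cong = begin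
  sumVecs n (λ x → (x == L (π x)) ∧ h x)
    ≡⟨ sumVecs-cong n (λ x → sym (sumVecs-sift k (π x) (λ c → (x == L c) ∧ h x)
                                    (λ c≗c′ → cong (_∧ h x) (==-cong (λ _ → refl) (L-cong c≗c′))))) ⟩
  sumVecs n (λ x → sumVecs k (λ c → (c == π x) ∧ ((x == L c) ∧ h x)))
    ≡⟨ sumVecs-swap n k (λ x c → (c == π x) ∧ ((x == L c) ∧ h x)) ⟩
  sumVecs k (λ c → sumVecs n (λ x → (c == π x) ∧ ((x == L c) ∧ h x)))
    ≡⟨ sumVecs-cong k (λ c → sumVecs-cong n (on-graph c)) ⟩
  sumVecs k (λ c → sumVecs n (λ x → (x == L c) ∧ h (L c)))
    ≡⟨ sumVecs-cong k (λ c → sumVecs-sift n (L c) (const (h (L c))) (λ _ → refl)) ⟩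
  sumVecs k (h ∘ L)
    ∎
  where
  open ≡-Reasoning
  on-graph : ∀ c x → (c == π x) ∧ ((x == L c) ∧ h x) ≡ (x == L c) ∧ h (L c)
  on-graph c x with x == L c in x==Lc
  ... | false = ∧-zeroʳ _
  ... | true  = cong₂ _∧_ c==πx (h-cong x≗Lc)
    where
    x≗Lc = ==-sound x (L c) x==Lc
    c==πx : c == π x ≡ true
    c==πx = ==-complete (λ i → sym (trans (π-cong x≗Lc i) (πL≗id c i)))

allB-true⁻ : (p : A → Bool) {xs : List A} → allB p xs ≡ true → ∀ {x} → x ∈ xs → p x ≡ true
allB-true⁻ p {y ∷ xs} all-p (here refl) = proj₁ (∧-≡true (p y) all-p)
allB-true⁻ p {y ∷ xs} all-p (there x∈) = allB-true⁻ p (proj₂ (∧-≡true (p y) all-p)) x∈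

allB-true⁺ : (p : A → Bool) (xs : List A) → (∀ x → p x ≡ true) → allB p xs ≡ true
allB-true⁺ p []       all-p = refl
allB-true⁺ p (x ∷ xs) all-p rewrite all-p x = allB-true⁺ p xs all-p

allB-cong : {p q : A → Bool} (xs : List A) → p ≗ q → allB p xs ≡ allB q xs
allB-cong []       p≗q = refl
allB-cong (x ∷ xs) p≗q = cong₂ _∧_ (p≗q x) (allB-cong xs p≗q)

allB-allFin : (v : Vec2 n) → allB v (allFin n) ≡ true ⇔ (∀ i → v i ≡ true)
allB-allFin {n} v = mk⇔ (λ all-v i → allB-true⁻ v all-v (∈-allFin i)) (allB-true⁺ v (allFin n))

allB-allFin≡==true : (v : Vec2 n) → allB v (allFin n) ≡ v == const true
allB-allFin≡==true v = ⇔→≡ (mk⇔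
  (λ all-v → ==-complete (Equivalence.to (allB-allFin v) all-v))
  (λ v==1 → Equivalence.from (allB-allFin v) (==-sound v (const true) v==1)))

-- Row combinations and row spaces

combo-cong : (M : Mat2 r s) → Congruent _≗_ _≗_ (combo M)
combo-cong {r} M v≗w j = cong sumF2 (map-cong (λ i → cong (_∧ M i j) (v≗w i)) (allFin r))

combo-⊕ : (M : Mat2 r s) (v w : Vec2 r) → combo M (v ⊕ w) ≗ combo M v ⊕ combo M w
combo-⊕ {r} M v w j = trans
  (cong sumF2 (map-cong (λ i → ∧-distribʳ-xor (M i j) (v i) (w i)) (allFin r)))
  (sumF2-xor (λ i → v i ∧ M i j) (λ i → w i ∧ M i j) (allFin r))

module UnitPivotColumns {k n} (G : Mat2 k n) (p : Fin k → Fin n)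
  (pivot≡true : ∀ i → G i (p i) ≡ true) (off-pivot≡false : ∀ i j → i ≢ j → G j (p i) ≡ false) where

  combo-pivot : ∀ c i → combo G c (p i) ≡ c i
  combo-pivot c i = begin
    sumF2 (map (λ l → c l ∧ G l (p i)) (allFin k))  ≡⟨ cong sumF2 (map-tabulate id (λ l → c l ∧ G l (p i))) ⟩
    sumF2 (tabulate (λ l → c l ∧ G l (p i)))        ≡⟨ sumF2-tabulate-single _ i others-vanish ⟩
    c i ∧ G i (p i)                                 ≡⟨ cong (c i ∧_) (pivot≡true i) ⟩
    c i ∧ true                                      ≡⟨ ∧-identityʳ (c i) ⟩
    c i                                             ∎
    where
    open ≡-Reasoning
    others-vanish : ∀ l → l ≢ i → c l ∧ G l (p i) ≡ false
    others-vanish l l≢i = trans (cong (c l ∧_) (off-pivot≡false i l (l≢i ∘ sym))) (∧-zeroʳ (c l))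

  -- Reading off the pivot coordinates of x ∈ U recovers the coefficients of x.
  rowSpan-member : ∀ {U} → RowSpan G U → ∀ x → U x ≡ x == combo G (x ∘ p)
  rowSpan-member {U} span x = ⇔→≡ (mk⇔ to from)
    where
    to : U x ≡ true → x == combo G (x ∘ p) ≡ true
    to x∈U with c , cG≗x ← proj₁ (span x) x∈U =
      ==-complete (λ j → trans (sym (cG≗x j))
                               (combo-cong G (λ i → trans (sym (combo-pivot c i)) (cG≗x (p i))) j))
    from : x == combo G (x ∘ p) ≡ true → U x ≡ true
    from eq = proj₂ (span x) (x ∘ p , λ j → sym (==-sound x _ eq j))

  sumOver-rowSpan : ∀ {U} → RowSpan G U → (h : Vec2 n → Bool) → Congruent _≗_ _≡_ h →
    sumOver U h ≡ sumVecs k (h ∘ combo G)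
  sumOver-rowSpan {U} span h h-cong = begin
    sumOver U h                                     ≡⟨ sumF2-allVecs n (λ x → U x ∧ h x) U∧h-cong ⟩
    sumVecs n (λ x → U x ∧ h x)                     ≡⟨ sumVecs-cong n (λ x → cong (_∧ h x) (member x)) ⟩
    sumVecs n (λ x → (x == combo G (x ∘ p)) ∧ h x)  ≡⟨ sumVecs-section (combo G) (_∘ p) (combo-cong G)
                                                         (_∘ p) combo-pivot h h-cong ⟩
    sumVecs k (h ∘ combo G)                         ∎
    where
    open ≡-Reasoning
    member = rowSpan-member span
    U∧h-cong : Congruent _≗_ _≡_ (λ x → U x ∧ h x)
    U∧h-cong {x} {y} x≗y = cong₂ _∧_
      (trans (member x) (trans (==-cong x≗y (combo-cong G (x≗y ∘ p))) (sym (member y))))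
      (h-cong x≗y)

-- Parity of the number of solutions of c M = b

Independent : Mat2 r s → Set
Independent {r} M = ∀ a → combo M a ≗ const false → a ≗ const false

independent⇒injective : (M : Mat2 r s) → Independent M → Injective _≗_ _≗_ (combo M)
independent⇒injective M indep {v} {w} vM≗wM i = xor-≡false (indep (v ⊕ w) (λ j → begin
  combo M (v ⊕ w) j             ≡⟨ combo-⊕ M v w j ⟩
  combo M v j xor combo M w j   ≡⟨ cong (_xor combo M w j) (vM≗wM j) ⟩
  combo M w j xor combo M w j   ≡⟨ xor-same (combo M w j) ⟩
  false                         ∎) i)
  where
  open ≡-Reasoning
  xor-≡false : ∀ {x y} → x xor y ≡ false → x ≡ y
  xor-≡false {false} {false} _ = refl
  xor-≡false {true}  {true}  _ = refl

Fin-injective⇒surjective : (f : Fin n → Fin n) → Injective _≡_ _≡_ f → ∀ t → ∃ λ i → f i ≡ t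
Fin-injective⇒surjective {suc n} f f-inj t with any? (λ i → f i ≟ t)
... | yes hit  = hit
... | no  miss = ⊥-elim (1+n≰n (injective⇒≤ {f = squeeze} squeeze-injective))
  where
  f≢t : ∀ i → t ≢ f i
  f≢t i t≡fi = miss (i , sym t≡fi)
  squeeze : Fin (suc n) → Fin n
  squeeze i = punchOut (f≢t i)
  squeeze-injective : Injective _≡_ _≡_ squeeze
  squeeze-injective {i} {j} eq = f-inj (punchOut-injective (f≢t i) (f≢t j) eq)

encode : Vec2 k → Fin (2 ^ k)
encode v = funToFin (Inverse.from 2↔Bool ∘ v)

decode : Fin (2 ^ k) → Vec2 k
decode i = Inverse.to 2↔Bool ∘ finToFun i

decode-encode : (v : Vec2 k) → decode (encode v) ≗ v
decode-encode v j = trans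
  (cong (Inverse.to 2↔Bool) (finToFun-funToFin (Inverse.from 2↔Bool ∘ v) j))
  (Inverse.strictlyInverseˡ 2↔Bool (v j))

decode-injective : Injective _≡_ _≗_ (decode {k})
decode-injective {k} {i} {j} di≗dj = begin
  i                                 ≡⟨ funToFin-finToFin {k} {2} i ⟨
  funToFin (finToFun {2} {k} i)     ≡⟨ funToFin-cong (λ x → Injection.injective (↔⇒↣ 2↔Bool) (di≗dj x)) ⟩
  funToFin (finToFun {2} {k} j)     ≡⟨ funToFin-finToFin {k} {2} j ⟩
  j                                 ∎
  where
  open ≡-Reasoning
  funToFin-cong : ∀ {m} {f g : Fin m → Fin 2} → f ≗ g → funToFin f ≡ funToFin g
  funToFin-cong {zero}  f≗g = refl
  funToFin-cong {suc m} f≗g = cong₂ combine (f≗g zero) (funToFin-cong (f≗g ∘ suc))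

Vec2-injective⇒surjective : (f : Vec2 k → Vec2 k) → Injective _≗_ _≗_ f → ∀ b → ∃ λ c → f c ≗ b
Vec2-injective⇒surjective {k} f f-inj b = decode i , via-encode F[i]≡encode[b]
  where
  F : Fin (2 ^ k) → Fin (2 ^ k)
  F = encode ∘ f ∘ decode
  via-encode : ∀ {v w} → encode v ≡ encode w → v ≗ w
  via-encode {v} {w} eq x = trans (sym (decode-encode v x))
                                  (trans (cong (λ t → decode t x) eq) (decode-encode w x))
  F-injective : Injective _≡_ _≡_ F
  F-injective = decode-injective ∘ f-inj ∘ via-encode
  i = proj₁ (Fin-injective⇒surjective F F-injective (encode b))
  F[i]≡encode[b] = proj₂ (Fin-injective⇒surjective F F-injective (encode b))

independent⇒sumVecs-solutions : (M : Mat2 k k) → Independent M →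
  ∀ b → sumVecs k (λ c → combo M c == b) ≡ true
independent⇒sumVecs-solutions {k} M indep b =
  trans (sumVecs-cong k (λ c → ⇔→≡ (mk⇔ (solution⇒c₀ c) (c₀⇒solution c)))) (sumVecs-== k c₀)
  where
  M-injective = independent⇒injective M indep
  c₀ = proj₁ (Vec2-injective⇒surjective (combo M) M-injective b)
  c₀M≗b = proj₂ (Vec2-injective⇒surjective (combo M) M-injective b)
  solution⇒c₀ : ∀ c → combo M c == b ≡ true → c == c₀ ≡ true
  solution⇒c₀ c cM==b = ==-complete (M-injective (λ j → trans (==-sound _ b cM==b j) (sym (c₀M≗b j))))
  c₀⇒solution : ∀ c → c == c₀ ≡ true → combo M c == b ≡ true
  c₀⇒solution c c==c₀ = ==-complete (λ j → trans (combo-cong M (==-sound c c₀ c==c₀) j) (c₀M≗b j))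

sumVecs-solutions⇒independent : (M : Mat2 r s) (b : Vec2 s) →
  sumVecs r (λ c → combo M c == b) ≡ true → Independent M
sumVecs-solutions⇒independent {r} M b odd a aM≗0 i with a i in aᵢ
... | false = refl
... | true  = trans (sym odd) (sumVecs-periodic r solves solves-cong a i aᵢ periodic)
  where
  solves : Vec2 r → Bool
  solves c = combo M c == b
  solves-cong : Congruent _≗_ _≡_ solves
  solves-cong v≗w = ==-cong (combo-cong M v≗w) (λ _ → refl)
  periodic : ∀ c → solves (c ⊕ a) ≡ solves c
  periodic c = ==-cong (λ j → trans (combo-⊕ M c a j)
                                   (trans (cong (combo M c j xor_) (aM≗0 j)) (xor-identityʳ _)))
                       (λ _ → refl)

-- Rank

allVecs-complete : ∀ n (v : Vec2 n) → ∃ λ w → w ∈ allVecs n × w ≗ v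
allVecs-complete zero    v = (λ ()) , here refl , λ ()
allVecs-complete (suc n) v with allVecs-complete n (tail v) | v zero in v₀
... | w , w∈ , w≗ | false =
  _ , ∈-concat⁺′ (here refl) (∈-map⁺ _ w∈) , λ { zero → sym v₀ ; (suc i) → w≗ i }
... | w , w∈ , w≗ | true  =
  _ , ∈-concat⁺′ (there (here refl)) (∈-map⁺ _ w∈) , λ { zero → sym v₀ ; (suc i) → w≗ i }

size≤ : (S : Vec2 n) → size S ≤ n
size≤ {n} S = ≤-trans (length-filter (T? ∘ S) (allFin n)) (≤-reflexive (length-tabulate id))

full⇒size≡ : (S : Vec2 n) → S ≗ const true → size S ≡ n
full⇒size≡ {n} S full = trans
  (cong length (filter-all (T? ∘ S) (All.tabulate⁺ (λ i → Equivalence.from T-≡ (full i)))))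
  (length-tabulate id)

size≡⇒full : (S : Vec2 n) → size S ≡ n → S ≗ const true
size≡⇒full {n} S size≡n i with S i in Sᵢ
... | true  = refl
... | false = ⊥-elim (n≮n n (subst₂ _<_ size≡n (length-tabulate id) shorter))
  where
  shorter : size S < length (allFin n)
  shorter = filter-notAll (T? ∘ S) (allFin n) (lose (∈-allFin i) (λ T[Sᵢ] → subst T Sᵢ T[Sᵢ]))

isZero⇔ : (v : Vec2 n) → isZero v ≡ true ⇔ v ≗ const false
isZero⇔ {n} v = mk⇔
  (λ zero-v i → not-injective (allB-true⁻ (not ∘ v) zero-v (∈-allFin i)))
  (λ v≗0 → allB-true⁺ (not ∘ v) (allFin n) (cong not ∘ v≗0))

indepSize : Mat2 r s → Vec2 r → ℕ
indepSize M S = if indepRows M S then size S else 0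

indepSize≤rank : (M : Mat2 r s) {S : Vec2 r} → S ∈ allVecs r → indepSize M S ≤ rank M
indepSize≤rank {r} M {S} S∈ =
  foldr-preservesᵒ {P = indepSize M S ≤_} {f = _⊔_} (λ x y → [ m≤n⇒m≤n⊔o y , m≤n⇒m≤o⊔n x ])
    0 (map (indepSize M) (allVecs r)) (inj₂ (lose (∈-map⁺ (indepSize M) S∈) ≤-refl))

rank≤rows : (M : Mat2 r s) → rank M ≤ r
rank≤rows {r} M =
  foldr-preservesᵇ {P = _≤ r} {f = _⊔_} ⊔-lub z≤n (All.map⁺ (universal indepSize≤ (allVecs r)))
  where
  indepSize≤ : ∀ S → indepSize M S ≤ r
  indepSize≤ S with indepRows M S
  ... | true  = size≤ S
  ... | false = z≤n

independent⇒indepRows : (M : Mat2 r s) → Independent M → ∀ S → indepRows M S ≡ true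
independent⇒indepRows {r} M indep S = allB-true⁺ _ (allVecs r) clause
  where
  clause : ∀ a → not (subsetOf a S ∧ not (isZero a)) ∨ not (isZero (combo M a)) ≡ true
  clause a with isZero (combo M a) in aM≡0
  ... | false = ∨-zeroʳ _
  ... | true  rewrite Equivalence.from (isZero⇔ a) (indep a (Equivalence.to (isZero⇔ (combo M a)) aM≡0)) =
    trans (∨-identityʳ _) (cong not (∧-zeroʳ (subsetOf a S)))

indepRows⇒independent : (M : Mat2 r s) (S : Vec2 r) → indepRows M S ≡ true → S ≗ const true →
  Independent M
indepRows⇒independent {r} M S indep full a aM≗0 i with allVecs-complete r a
... | w , w∈ , w≗a = trans (sym (w≗a i)) (Equivalence.to (isZero⇔ w) w≡0 i)
  where
  w⊆S : subsetOf w S ≡ true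
  w⊆S = allB-true⁺ _ (allFin r) (λ j → trans (cong (not (w j) ∨_) (full j)) (∨-zeroʳ _))
  wM≡0 : isZero (combo M w) ≡ true
  wM≡0 = Equivalence.from (isZero⇔ (combo M w)) (λ j → trans (combo-cong M w≗a j) (aM≗0 j))
  clause⇒ : ∀ {x y z} → not (x ∧ not y) ∨ not z ≡ true → x ≡ true → z ≡ true → y ≡ true
  clause⇒ {true} {true}  {true} _  _ _ = refl
  clause⇒ {true} {false} {true} () _ _
  w≡0 : isZero w ≡ true
  w≡0 = clause⇒ (allB-true⁻ _ indep w∈) w⊆S wM≡0

independent⇒rank≡rows : (M : Mat2 r s) → Independent M → rank M ≡ r
independent⇒rank≡rows {r} M indep with allVecs-complete r (const true)
... | S , S∈ , full = ≤-antisym (rank≤rows M) (begin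
  r              ≡⟨ full⇒size≡ S full ⟨
  size S         ≡⟨ cong (λ b → if b then size S else 0) (independent⇒indepRows M indep S) ⟨
  indepSize M S  ≤⟨ indepSize≤rank M S∈ ⟩
  rank M         ∎)
  where open ≤-Reasoning

rank≡rows⇒independent : (M : Mat2 r s) → rank M ≡ r → Independent M
rank≡rows⇒independent {zero}  M _ a _ ()
rank≡rows⇒independent {suc r} M rank≡r with foldr-selective ⊔-sel 0 (map (indepSize M) (allVecs (suc r)))
... | inj₁ rank≡0 = ⊥-elim (0≢1+n (trans (sym rank≡0) rank≡r))
... | inj₂ rank∈ with ∈-map⁻ (indepSize M) rank∈
...   | S , S∈ , rank≡size with indepRows M S in indep
...     | true  = indepRows⇒independent M S indep (size≡⇒full S (trans (sym rank≡size) rank≡r))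
...     | false = ⊥-elim (0≢1+n (trans (sym rank≡size) rank≡r))

-- Monomials

allB-filter : (I x : Vec2 n) (is : List (Fin n)) →
  allB (λ i → not (I i) ∨ x i) is ≡ allB x (filter (T? ∘ I) is)
allB-filter I x []       = refl
allB-filter I x (i ∷ is) with I i
... | true  = cong (x i ∧_) (allB-filter I x is)
... | false = allB-filter I x is

evalMono-lookup : (m : Monomial n) (x : Vec2 n) →
  evalMono m x ≡ allB (x ∘ lookup (elems (Var m))) (allFin (length (elems (Var m))))
evalMono-lookup {n} m x = begin
  evalMono m x                            ≡⟨ allB-filter (Var m) x (allFin n) ⟩
  allB x is                               ≡⟨ cong (allB x) (trans (map-tabulate id (lookup is)) (tabulate-lookup is)) ⟨
  allB x (map (lookup is) (allFin ∣is∣))  ≡⟨ foldr-map _ (lookup is) true (allFin ∣is∣) ⟩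
  allB (x ∘ lookup is) (allFin ∣is∣)      ∎
  where
  open ≡-Reasoning
  is = elems (Var m)
  ∣is∣ = length is

evalMono-cong : (m : Monomial n) → Congruent _≗_ _≡_ (evalMono m)
evalMono-cong {n} m x≗y = allB-cong (allFin n) (λ i → cong (not (Var m i) ∨_) (x≗y i))

evalMono-combo : (G : Mat2 k n) (m : Monomial n) (c : Vec2 k) →
  evalMono m (combo G c) ≡ combo (submatrix G (Var m)) c == const true
evalMono-combo G m c =
  trans (evalMono-lookup m (combo G c)) (allB-allFin≡==true (combo (submatrix G (Var m)) c))

theorem4p3 : (n k : ℕ) (m : Monomial n) → degree m ≡ k →
    (U : Vec2 n → Bool) → IsSubspace U →
    (G : Mat2 k n) → IsRREF G → RowSpan G U →
    InN m U ⇔ (rank (submatrix G (Var m)) ≡ k)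
theorem4p3 n .(degree m) m refl U _ G (p , _ , pivot≡true , _ , off-pivot≡false) span = mk⇔
  (λ odd → independent⇒rank≡rows Gₘ (sumVecs-solutions⇒independent Gₘ 𝟙 (trans (sym parity) odd)))
  (λ rank≡k → trans parity (independent⇒sumVecs-solutions Gₘ (rank≡rows⇒independent Gₘ rank≡k) 𝟙))
  where
  Gₘ = submatrix G (Var m)
  𝟙 = const true
  parity : sumOver U (evalMono m) ≡ sumVecs (degree m) (λ c → combo Gₘ c == 𝟙)
  parity = trans (UnitPivotColumns.sumOver-rowSpan G p pivot≡true off-pivot≡false span
                   (evalMono m) (evalMono-cong m))
                 (sumVecs-cong (degree m) (evalMono-combo G m))
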